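{- Let $G$ be a graph on $n$ vertices with maximum degree $\Delta$, and let $L=\{1,\dots,l\}$ be the label set. If $|L|\ge(\Delta^2+1)n+\Delta\binom{n-1}{2}$, then Alice has a winning strategy in the ESD labeling game on $G$ with label set $L$.
   Context: For a graph $G=(V,E)$ and $l\in\mathbb N$, a vertex labeling $\phi:V\to\{1,\dots,l\}$ is an edge-sum distinguishing (ESD) labeling if $\phi$ is injective and the edge-weights $w_\phi(uv)=\phi(u)+\phi(v)$ are pairwise distinct over all edges $uv\in E$. ESD labeling game on $G$ with label set $L=\{1,\dots,l\}$: Alice and Bob alternate moves, Alice starting. In each move the player chooses a not-yet-labeled vertex and assigns to it a label from $L$ not used before; the move is legal if the edge-weights of edges with both endpoints labeled remain pairwise distinct. The game ends when no legal move is possible or an ESD labeling of $G$ is created; Alice wins if an ESD labeling is created, otherwise Bob wins. -}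

module Defs where

open import Data.Nat using (ℕ; zero; suc; _+_; _*_; _∸_; _≤_; _⊔_)
open import Data.Nat.Combinatorics public using (_C_)
open import Data.Bool using (Bool; true; false; if_then_else_)
open import Data.Fin using (Fin)
open import Data.Fin.Properties using () renaming (_≟_ to _≟ᶠ_)
open import Data.List using (List; map; foldr; allFin)
open import Data.Nat.ListAction using (sum)
open import Data.Maybe using (Maybe; just; nothing)
open import Data.Product using (Σ; ∃; _×_; _,_)
open import Data.Sum using (_⊎_)
open import Relation.Nullary using (¬_; yes; no)
open import Relation.Binary.PropositionalEquality using (_≡_; _≢_)

record Graph (n : ℕ) : Set where
  field
    adj   : Fin n → Fin n → Bool
    sym   : ∀ u v → adj u v ≡ adj v u
    irrefl : ∀ v → adj v v ≡ false
open Graph public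

degree : ∀ {n} → Graph n → Fin n → ℕ
degree {n} G v = sum (map (λ w → if adj G v w then 1 else 0) (allFin n))

maxDegree : ∀ {n} → Graph n → ℕ
maxDegree {n} G = foldr _⊔_ 0 (map (degree G) (allFin n))

SameEdge : ∀ {n} → Fin n → Fin n → Fin n → Fin n → Set
SameEdge u v x y = (u ≡ x × v ≡ y) ⊎ (u ≡ y × v ≡ x)

IsESD : ∀ {n} → Graph n → ℕ → (Fin n → ℕ) → Set
IsESD G l φ =
    (∀ v → 1 ≤ φ v × φ v ≤ l)
  × (∀ u v → φ u ≡ φ v → u ≡ v)
  × (∀ u v x y → adj G u v ≡ true → adj G x y ≡ true →
       φ u + φ v ≡ φ x + φ y → SameEdge u v x y)

-- game positions: partial labelings
Position : ℕ → Set
Position n = Fin n → Maybe ℕ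

empty : ∀ {n} → Position n
empty _ = nothing

assign : ∀ {n} → Position n → Fin n → ℕ → Position n
assign s v a w with w ≟ᶠ v
... | yes _ = just a
... | no  _ = s w

WeightsDistinct : ∀ {n} → Graph n → Position n → Set
WeightsDistinct G s = ∀ u v x y a b c d → adj G u v ≡ true → adj G x y ≡ true →
  s u ≡ just a → s v ≡ just b → s x ≡ just c → s y ≡ just d →
  a + b ≡ c + d → SameEdge u v x y

Legal : ∀ {n} → Graph n → ℕ → Position n → Fin n → ℕ → Set
Legal G l s v a =
    s v ≡ nothing
  × (1 ≤ a × a ≤ l)
  × (∀ w → s w ≢ just a)
  × WeightsDistinct G (assign s v a)

Created : ∀ {n} → Graph n → ℕ → Position n → Set
Created G l s = Σ (_ → ℕ) λ φ → (∀ v → s v ≡ just (φ v)) × IsESD G l φ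

-- The game is finite (each move labels
-- a vertex), so winning strategies are well-founded trees.
mutual
  data AliceWinsAliceToMove {n} (G : Graph n) (l : ℕ) (s : Position n) : Set where
    created : Created G l s → AliceWinsAliceToMove G l s
    play    : (v : Fin n) (a : ℕ) → Legal G l s v a →
              AliceWinsBobToMove G l (assign s v a) → AliceWinsAliceToMove G l s

  data AliceWinsBobToMove {n} (G : Graph n) (l : ℕ) (s : Position n) : Set where
    created : Created G l s → AliceWinsBobToMove G l s
    respond : (∃ λ v → ∃ λ a → Legal G l s v a) →
              (∀ v a → Legal G l s v a → AliceWinsAliceToMove G l (assign s v a)) →
              AliceWinsBobToMove G l s

AliceWins : ∀ {n} → Graph n → ℕ → Set
AliceWins G l = AliceWinsAliceToMove G l empty

module Submission where

-- Alice wins with a greedy strategy that never looks ahead.  On her turn she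
-- labels any unlabelled vertex v with a label a that is not *forbidden*:
-- a is forbidden if it is already used, or if a + b = c + d for a labelled
-- neighbour w of v (label b) and an edge xy whose ends are labelled c and d.
-- At most n - 1 labels are used and at most Δ · (n · Δ) values clash, so
-- fewer than n + Δ²n ≤ l labels are forbidden and a free one exists
-- (pigeonhole); a label that is not forbidden is a legal move.  Every legal
-- move, Alice's or Bob's, keeps the position a valid partial ESD labelling,
-- so the game can only end with all vertices labelled, and a complete valid
-- position is an ESD labelling.

open import Defs hiding (sym)
open import Data.Nat using (ℕ; suc; _+_; _*_; _∸_; _≤_; _<_; z≤n; s≤s; s≤s⁻¹; _⊔_)
open import Data.Nat.Properties
open import Data.Nat.ListAction using (sum)
open import Data.Nat.Solver using (module +-*-Solver)
open import Data.Bool using (true; false; if_then_else_)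
open import Data.Fin using (Fin)
open import Data.Fin.Properties using (any?) renaming (_≟_ to _≟ᶠ_)
open import Data.List using (List; []; _∷_; _++_; length; map; foldr; concatMap; filter; allFin)
open import Data.List.Properties using (length-++; length-tabulate; filter-notAll)
open import Data.List.Relation.Unary.Any as Any using (here; there)
open import Data.List.Membership.Propositional using (_∈_; _∉_; lose)
open import Data.List.Membership.Propositional.Properties
  using (∈-concatMap⁺; ∈-allFin; ∈-++⁺ˡ; ∈-++⁺ʳ; ∈-filter⁺)
open import Data.List.Membership.DecPropositional _≟_ using (_∈?_)
open import Data.Maybe using (Maybe; just; nothing)
open import Data.Maybe.Properties using (just-injective; ≡-dec)
open import Data.Product using (∃; _×_; _,_; proj₁; proj₂)
open import Data.Sum using (_⊎_; inj₁; inj₂)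
open import Data.Empty using (⊥; ⊥-elim)
open import Function using (_∘_; id)
open import Relation.Nullary using (yes; no; ¬?; contradiction)
open import Relation.Binary.PropositionalEquality
  using (_≡_; _≢_; refl; sym; trans; cong; subst)

module _ {A : Set} where

  length-concatMap : {B : Set} (f : A → List B) (xs : List A) →
                     length (concatMap f xs) ≡ sum (map (length ∘ f) xs)
  length-concatMap f []       = refl
  length-concatMap f (x ∷ xs) =
    trans (length-++ (f x)) (cong (length (f x) +_) (length-concatMap f xs))

  sum-map-mono : {f g : A → ℕ} (xs : List A) → (∀ x → f x ≤ g x) →
                 sum (map f xs) ≤ sum (map g xs)
  sum-map-mono []       f≤g = z≤n
  sum-map-mono (x ∷ xs) f≤g = +-mono-≤ (f≤g x) (sum-map-mono xs f≤g)

  sum-map-strict : {f g : A → ℕ} {x : A} (xs : List A) → (∀ y → f y ≤ g y) →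
                   x ∈ xs → f x < g x → sum (map f xs) < sum (map g xs)
  sum-map-strict (y ∷ xs) f≤g (here refl) fx<gx = +-mono-<-≤ fx<gx (sum-map-mono xs f≤g)
  sum-map-strict (y ∷ xs) f≤g (there x∈xs) fx<gx =
    +-mono-≤-< (f≤g y) (sum-map-strict xs f≤g x∈xs fx<gx)

  sum-map-const : (k : ℕ) (xs : List A) → sum (map (λ _ → k) xs) ≡ length xs * k
  sum-map-const k []       = refl
  sum-map-const k (x ∷ xs) = cong (k +_) (sum-map-const k xs)

  sum-map-*ʳ : (f : A → ℕ) (k : ℕ) (xs : List A) →
               sum (map (λ x → f x * k) xs) ≡ sum (map f xs) * k
  sum-map-*ʳ f k []       = refl
  sum-map-*ʳ f k (x ∷ xs) =
    trans (cong (f x * k +_) (sum-map-*ʳ f k xs)) (sym (*-distribʳ-+ k (f x) _))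

  ≤-maximum : (f : A → ℕ) {x : A} (xs : List A) → x ∈ xs → f x ≤ foldr _⊔_ 0 (map f xs)
  ≤-maximum f (y ∷ xs) (here refl)  = m≤m⊔n (f y) _
  ≤-maximum f (y ∷ xs) (there x∈xs) =
    ≤-trans (≤-maximum f xs x∈xs) (m≤n⊔m (f y) _)

-- Pigeonhole for labels: fewer than l forbidden values leave a label in {1,…,l}.
-- If l itself is forbidden, drop its occurrences and recurse on {1,…,l-1}.
free-label : ∀ l (F : List ℕ) → length F < l → ∃ λ a → (1 ≤ a × a ≤ l) × a ∉ F
free-label (suc l) F |F|≤l with suc l ∈? F
... | no l∉F = suc l , (s≤s z≤n , ≤-refl) , l∉F
... | yes l∈F with free-label l F′ (<-≤-trans shorter (s≤s⁻¹ |F|≤l))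
  where
  F′ : List ℕ
  F′ = filter (λ x → ¬? (x ≟ suc l)) F
  shorter : length F′ < length F
  shorter = filter-notAll (λ x → ¬? (x ≟ suc l)) F (Any.map (λ e ne → ne (sym e)) l∈F)
... | a , (1≤a , a≤l) , a∉F′ =
  a , (1≤a , m≤n⇒m≤1+n a≤l) ,
  λ a∈F → a∉F′ (∈-filter⁺ (λ x → ¬? (x ≟ suc l)) a∈F λ a≡ → 1+n≰n (subst (_≤ l) a≡ a≤l))

SameEdge-swapˡ : ∀ {n} {p q x y : Fin n} → SameEdge p q x y → SameEdge q p x y
SameEdge-swapˡ (inj₁ (p≡x , q≡y)) = inj₂ (q≡y , p≡x)
SameEdge-swapˡ (inj₂ (p≡y , q≡x)) = inj₁ (q≡x , p≡y)

SameEdge-sym : ∀ {n} {p q x y : Fin n} → SameEdge p q x y → SameEdge x y p q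
SameEdge-sym (inj₁ (p≡x , q≡y)) = inj₁ (sym p≡x , sym q≡y)
SameEdge-sym (inj₂ (p≡y , q≡x)) = inj₂ (sym q≡x , sym p≡y)

SameEdge-swapʳ : ∀ {n} {p q x y : Fin n} → SameEdge p q x y → SameEdge p q y x
SameEdge-swapʳ = SameEdge-sym ∘ SameEdge-swapˡ ∘ SameEdge-sym

degree≤maxDegree : ∀ {n} (G : Graph n) (v : Fin n) → degree G v ≤ maxDegree G
degree≤maxDegree {n} G v = ≤-maximum (degree G) (allFin n) (∈-allFin v)

assign-view : ∀ {n} (s : Position n) v a {u t} → assign s v a u ≡ just t →
              (u ≡ v × t ≡ a) ⊎ s u ≡ just t
assign-view s v a {u} eq with u ≟ᶠ v
... | yes u≡v = inj₁ (u≡v , sym (just-injective eq))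
... | no  _   = inj₂ eq

-- A valid position: the labelled part is injective, uses labels from
-- {1,…,l} and has pairwise distinct edge weights.  This is the invariant
-- of the game as long as Alice is winning.
record Valid {n} (G : Graph n) (l : ℕ) (s : Position n) : Set where
  field
    distinct  : WeightsDistinct G s
    injective : ∀ u w {b} → s u ≡ just b → s w ≡ just b → u ≡ w
    inRange   : ∀ u {b} → s u ≡ just b → 1 ≤ b × b ≤ l
open Valid

valid-empty : ∀ {n} {G : Graph n} {l} → Valid G l empty
valid-empty = record { distinct = λ _ _ _ _ _ _ _ _ _ _ () ; injective = λ _ _ () ; inRange = λ _ () }

legal-valid : ∀ {n} {G : Graph n} {l s v a} → Valid G l s → Legal G l s v a →
              Valid G l (assign s v a)
legal-valid {l = l} {s = s} {v} {a} valid (_ , a∈L , a-unused , distinct′) = record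
  { distinct = distinct′ ; injective = injective′ ; inRange = inRange′ }
  where
  injective′ : ∀ u w {b} → assign s v a u ≡ just b → assign s v a w ≡ just b → u ≡ w
  injective′ u w su sw with assign-view s v a su | assign-view s v a sw
  ... | inj₁ (u≡v , _)    | inj₁ (w≡v , _)    = trans u≡v (sym w≡v)
  ... | inj₁ (_ , refl)   | inj₂ sw′          = contradiction sw′ (a-unused _)
  ... | inj₂ su′          | inj₁ (_ , refl)   = contradiction su′ (a-unused _)
  ... | inj₂ su′          | inj₂ sw′          = injective valid u w su′ sw′
  inRange′ : ∀ u {b} → assign s v a u ≡ just b → 1 ≤ b × b ≤ l
  inRange′ u su with assign-view s v a su
  ... | inj₁ (_ , refl) = a∈L
  ... | inj₂ su′        = inRange valid u su′

complete-created : ∀ {n} {G : Graph n} {l s} → Valid G l s →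
                   (∀ u → ∃ λ b → s u ≡ just b) → Created G l s
complete-created {n} {s = s} valid full =
  φ , φ-labels , (λ u → inRange valid u (φ-labels u)) ,
  (λ u w φu≡φw → injective valid u w (φ-labels u) (subst (λ t → s w ≡ just t) (sym φu≡φw) (φ-labels w))) ,
  (λ u v x y uv xy w → distinct valid u v x y _ _ _ _ uv xy
                         (φ-labels u) (φ-labels v) (φ-labels x) (φ-labels y) w)
  where
  φ : Fin n → ℕ
  φ u = proj₁ (full u)
  φ-labels : ∀ u → s u ≡ just (φ u)
  φ-labels u = proj₂ (full u)

complete-or-open : ∀ {n} (s : Position n) → (∀ u → ∃ λ b → s u ≡ just b) ⊎ (∃ λ v → s v ≡ nothing)
complete-or-open s with any? (λ u → ≡-dec _≟_ (s u) nothing)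
... | yes open-vertex = inj₂ open-vertex
... | no  none-open   = inj₁ λ u → labelled u (s u) refl
  where
  labelled : ∀ u m → s u ≡ m → ∃ λ b → s u ≡ just b
  labelled u nothing  su = contradiction (u , su) none-open
  labelled u (just b) su = b , su

onLabel : Maybe ℕ → (ℕ → List ℕ) → List ℕ
onLabel nothing  f = []
onLabel (just b) f = f b

∈-onLabel : ∀ {m b t} {f : ℕ → List ℕ} → m ≡ just b → t ∈ f b → t ∈ onLabel m f
∈-onLabel refl t∈fb = t∈fb

length-onLabel : ∀ m (f : ℕ → List ℕ) {K} → (∀ b → length (f b) ≤ K) → length (onLabel m f) ≤ K
length-onLabel nothing  f f≤K = z≤n
length-onLabel (just b) f f≤K = f≤K b

module Forbidden {n} (G : Graph n) (Δ : ℕ) (degree≤Δ : ∀ v → degree G v ≤ Δ) where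

  no-loop : ∀ {x} → adj G x x ≡ true → ⊥
  no-loop {x} xx with trans (sym xx) (irrefl G x)
  ... | ()

  adj-sym : ∀ {x y} → adj G x y ≡ true → adj G y x ≡ true
  adj-sym {x} {y} xy = trans (Graph.sym G y x) xy

  ⋃-neighbours : Fin n → (Fin n → List ℕ) → List ℕ
  ⋃-neighbours v f = concatMap (λ w → if adj G v w then f w else []) (allFin n)

  ∈-⋃-neighbours : ∀ {v w t} (f : Fin n → List ℕ) → adj G v w ≡ true → t ∈ f w →
                   t ∈ ⋃-neighbours v f
  ∈-⋃-neighbours {v} {w} {t} f vw t∈fw =
    ∈-concatMap⁺ _ (lose (∈-allFin w) (subst (λ b → t ∈ (if b then f w else [])) (sym vw) t∈fw))

  length-⋃-neighbours : ∀ v (f : Fin n → List ℕ) {K} → (∀ w → length (f w) ≤ K) →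
                        length (⋃-neighbours v f) ≤ Δ * K
  length-⋃-neighbours v f {K} f≤K = begin
      length (⋃-neighbours v f)
    ≡⟨ length-concatMap _ (allFin n) ⟩
      sum (map (λ w → length (if adj G v w then f w else [])) (allFin n))
    ≤⟨ sum-map-mono (allFin n) (λ w → part (adj G v w) w) ⟩
      sum (map (λ w → (if adj G v w then 1 else 0) * K) (allFin n))
    ≡⟨ sum-map-*ʳ (λ w → if adj G v w then 1 else 0) K (allFin n) ⟩
      degree G v * K
    ≤⟨ *-monoˡ-≤ K (degree≤Δ v) ⟩
      Δ * K ∎
    where
    open ≤-Reasoning
    part : ∀ b w → length (if b then f w else []) ≤ (if b then 1 else 0) * K
    part true  w = subst (length (f w) ≤_) (sym (*-identityˡ K)) (f≤K w)
    part false w = z≤n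

  usedLabels : Position n → List ℕ
  usedLabels s = concatMap (λ u → onLabel (s u) (_∷ [])) (allFin n)

  edgeClash : Position n → ℕ → Fin n → Fin n → List ℕ
  edgeClash s b x y = onLabel (s x) λ c → onLabel (s y) λ d → (c + d ∸ b) ∷ []

  clashing : Position n → ℕ → List ℕ
  clashing s b = concatMap (λ x → ⋃-neighbours x (edgeClash s b x)) (allFin n)

  forbidden : Position n → Fin n → List ℕ
  forbidden s v = usedLabels s ++ ⋃-neighbours v (λ w → onLabel (s w) (clashing s))

  ∈-forbidden-used : ∀ {s v w a} → s w ≡ just a → a ∈ forbidden s v
  ∈-forbidden-used {s} {w = w} sw =
    ∈-++⁺ˡ (∈-concatMap⁺ _ (lose (∈-allFin w) (∈-onLabel sw (here refl))))

  ∈-forbidden-clash : ∀ {s v p x y a b c d} → adj G v p ≡ true → s p ≡ just b →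
                      adj G x y ≡ true → s x ≡ just c → s y ≡ just d →
                      a + b ≡ c + d → a ∈ forbidden s v
  ∈-forbidden-clash {s} {v} {x = x} {a = a} {b} {c} {d} vp sp xy sx sy weight =
    ∈-++⁺ʳ (usedLabels s)
      (∈-⋃-neighbours _ vp (∈-onLabel sp
        (∈-concatMap⁺ _ (lose (∈-allFin x) (∈-⋃-neighbours _ xy
          (∈-onLabel sx (∈-onLabel sy (here a≡c+d∸b))))))))
    where
    a≡c+d∸b : a ≡ c + d ∸ b
    a≡c+d∸b = trans (sym (m+n∸n≡m a b)) (cong (_∸ b) weight)

  length-usedLabels : ∀ s {v} → s v ≡ nothing → length (usedLabels s) < n
  length-usedLabels s {v} sv = begin-strict
      length (usedLabels s)
    ≡⟨ length-concatMap _ (allFin n) ⟩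
      sum (map (λ u → length (onLabel (s u) (_∷ []))) (allFin n))
    <⟨ sum-map-strict (allFin n) (λ u → length-onLabel (s u) _ λ _ → ≤-refl) (∈-allFin v)
         (subst (λ m → length (onLabel m (_∷ [])) < 1) (sym sv) (s≤s z≤n)) ⟩
      sum (map (λ _ → 1) (allFin n))
    ≡⟨ sum-map-const 1 (allFin n) ⟩
      length (allFin n) * 1
    ≡⟨ cong (_* 1) (length-tabulate {n = n} id) ⟩
      n * 1
    ≡⟨ *-identityʳ n ⟩
      n ∎
    where open ≤-Reasoning

  -- Each of the at most n · Δ (ordered) edges contributes one clashing value.
  length-clashing : ∀ s b → length (clashing s b) ≤ n * Δ
  length-clashing s b = begin
      length (clashing s b)
    ≡⟨ length-concatMap _ (allFin n) ⟩
      sum (map (λ x → length (⋃-neighbours x (edgeClash s b x))) (allFin n))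
    ≤⟨ sum-map-mono (allFin n) edges-at ⟩
      sum (map (λ _ → Δ) (allFin n))
    ≡⟨ sum-map-const Δ (allFin n) ⟩
      length (allFin n) * Δ
    ≡⟨ cong (_* Δ) (length-tabulate {n = n} id) ⟩
      n * Δ ∎
    where
    open ≤-Reasoning
    edges-at : ∀ x → length (⋃-neighbours x (edgeClash s b x)) ≤ Δ
    edges-at x = ≤-trans
      (length-⋃-neighbours x _ λ y → length-onLabel (s x) _ λ _ → length-onLabel (s y) _ λ _ → ≤-refl)
      (≤-reflexive (*-identityʳ Δ))

  length-forbidden : ∀ s {v} → s v ≡ nothing → length (forbidden s v) < n + Δ * (n * Δ)
  length-forbidden s {v} sv = begin-strict
      length (forbidden s v)
    ≡⟨ length-++ (usedLabels s) ⟩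
      length (usedLabels s) + length (⋃-neighbours v (λ w → onLabel (s w) (clashing s)))
    <⟨ +-mono-<-≤ (length-usedLabels s sv)
         (length-⋃-neighbours v _ λ w → length-onLabel (s w) _ (length-clashing s)) ⟩
      n + Δ * (n * Δ) ∎
    where open ≤-Reasoning

  module Extension {l} {s : Position n} (valid : Valid G l s) (v : Fin n) (a : ℕ)
                   (a∉forbidden : a ∉ forbidden s v) where

    s′ : Position n
    s′ = assign s v a

    data Endpoints (x y : Fin n) (c d : ℕ) : Set where
      newˡ : x ≡ v → c ≡ a → s y ≡ just d → Endpoints x y c d
      newʳ : y ≡ v → d ≡ a → s x ≡ just c → Endpoints x y c d
      old  : s x ≡ just c → s y ≡ just d → Endpoints x y c d

    endpoints : ∀ {x y c d} → adj G x y ≡ true → s′ x ≡ just c → s′ y ≡ just d →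
                Endpoints x y c d
    endpoints {x} {y} xy sx sy with assign-view s v a {x} sx | assign-view s v a {y} sy
    ... | inj₁ (refl , _)     | inj₁ (refl , _)     = ⊥-elim (no-loop xy)
    ... | inj₁ (x≡v , c≡a)    | inj₂ sy′            = newˡ x≡v c≡a sy′
    ... | inj₂ sx′            | inj₁ (y≡v , d≡a)    = newʳ y≡v d≡a sx′
    ... | inj₂ sx′            | inj₂ sy′            = old sx′ sy′

    -- A new edge vp cannot share its weight with another edge xy of s′.
    -- If xy is new too, it shares the end v and, by injectivity of the
    -- labels, also p; if xy is old, a would be forbidden.
    new-edge-distinct : ∀ {p x y b c d} → adj G v p ≡ true → s p ≡ just b →
                        adj G x y ≡ true → s′ x ≡ just c → s′ y ≡ just d →
                        a + b ≡ c + d → SameEdge v p x y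
    new-edge-distinct {p} {x} {y} {b} {c} {d} vp sp xy sx sy weight with endpoints xy sx sy
    ... | newˡ refl refl sy′ =
      inj₁ (refl , injective valid p y sp (subst (λ t → s y ≡ just t) (sym (+-cancelˡ-≡ a b d weight)) sy′))
    ... | newʳ refl refl sx′ =
      inj₂ (refl , injective valid p x sp
               (subst (λ t → s x ≡ just t) (sym (+-cancelˡ-≡ a b c (trans weight (+-comm c a)))) sx′))
    ... | old sx′ sy′ = contradiction (∈-forbidden-clash vp sp xy sx′ sy′ weight) a∉forbidden

    -- Hence all edge weights of s′ are distinct: reduce every case with a
    -- new edge to `new-edge-distinct`, and two old edges to validity of s.
    extension-distinct : WeightsDistinct G s′
    extension-distinct u₁ u₂ x y b₁ b₂ c d e₁ e₂ s₁ s₂ sx sy weight with endpoints e₁ s₁ s₂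
    ... | newˡ refl refl s₂′ = new-edge-distinct e₁ s₂′ e₂ sx sy weight
    ... | newʳ refl refl s₁′ =
      SameEdge-swapˡ (new-edge-distinct (adj-sym e₁) s₁′ e₂ sx sy (trans (+-comm a b₁) weight))
    ... | old s₁′ s₂′ with endpoints e₂ sx sy
    ...   | newˡ refl refl sy′ = SameEdge-sym (new-edge-distinct e₂ sy′ e₁ s₁ s₂ (sym weight))
    ...   | newʳ refl refl sx′ =
      SameEdge-swapʳ (SameEdge-sym
        (new-edge-distinct (adj-sym e₂) sx′ e₁ s₁ s₂ (trans (+-comm a c) (sym weight))))
    ...   | old sx′ sy′ = distinct valid u₁ u₂ x y b₁ b₂ c d e₁ e₂ s₁′ s₂′ sx′ sy′ weight

    label-unused : ∀ w → s w ≢ just a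
    label-unused w sw = a∉forbidden (∈-forbidden-used {s} {v} {w} sw)

  greedy-move : ∀ {l s v} → n + Δ * (n * Δ) ≤ l → Valid G l s → s v ≡ nothing →
                ∃ λ a → Legal G l s v a
  greedy-move {l} {s} {v} room valid sv
    with free-label l (forbidden s v) (<-≤-trans (length-forbidden s sv) room)
  ... | a , a∈L , a∉forbidden =
    a , sv , a∈L , label-unused , extension-distinct
    where open Extension valid v a a∉forbidden

blank : Maybe ℕ → ℕ
blank nothing  = 1
blank (just _) = 0

unlabelled : ∀ {n} → Position n → ℕ
unlabelled {n} s = sum (map (λ u → blank (s u)) (allFin n))

unlabelled-decreases : ∀ {n} (s : Position n) v a → s v ≡ nothing →
                       unlabelled (assign s v a) < unlabelled s
unlabelled-decreases {n} s v a sv = sum-map-strict (allFin n) pointwise (∈-allFin v) at-v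
  where
  pointwise : ∀ u → blank (assign s v a u) ≤ blank (s u)
  pointwise u with u ≟ᶠ v
  ... | yes _ = z≤n
  ... | no  _ = ≤-refl
  at-v : blank (assign s v a v) < blank (s v)
  at-v with v ≟ᶠ v
  ... | yes _   rewrite sv = s≤s z≤n
  ... | no  v≢v = contradiction refl v≢v

-- Bob's turn: he has a legal move (the greedy one),
-- and whatever legal move he makes keeps the position valid.  The fuel k
-- bounds the number of unlabelled vertices and drops at every move.
module Strategy {n} (G : Graph n) (Δ l : ℕ) (degree≤Δ : ∀ v → degree G v ≤ Δ)
                (room : n + Δ * (n * Δ) ≤ l) where
  open Forbidden G Δ degree≤Δ using (greedy-move)

  mutual
    alice-wins : ∀ k s → Valid G l s → unlabelled s < k → AliceWinsAliceToMove G l s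
    alice-wins (suc k) s valid fuel with complete-or-open s
    ... | inj₁ complete = created (complete-created valid complete)
    ... | inj₂ (v , sv) with greedy-move room valid sv
    ...   | a , legal = play v a legal
      (bob-wins k _ (legal-valid valid legal) (<-≤-trans (unlabelled-decreases s v a sv) (s≤s⁻¹ fuel)))

    bob-wins : ∀ k s → Valid G l s → unlabelled s < k → AliceWinsBobToMove G l s
    bob-wins (suc k) s valid fuel with complete-or-open s
    ... | inj₁ complete = created (complete-created valid complete)
    ... | inj₂ (v , sv) = respond (v , greedy-move room valid sv) λ v′ a′ legal →
      alice-wins k _ (legal-valid valid legal)
        (<-≤-trans (unlabelled-decreases s v′ a′ (proj₁ legal)) (s≤s⁻¹ fuel))

  alice-wins-from-empty : AliceWins G l
  alice-wins-from-empty = alice-wins (suc (unlabelled {n} empty)) empty valid-empty ≤-refl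

-- Theorem 13: with at least (Δ² + 1) n + Δ·C(n-1, 2) labels Alice wins.
-- Only the first term is needed, as n + Δ (n Δ) = (Δ² + 1) n.
theorem13 : ∀ (n : ℕ) (G : Graph n) (Δ l : ℕ) → maxDegree G ≡ Δ →
    (Δ * Δ + 1) * n + Δ * ((n ∸ 1) C 2) ≤ l → AliceWins G l
theorem13 n G Δ l maxDegree≡Δ enough = Strategy.alice-wins-from-empty G Δ l degree≤Δ room
  where
  open +-*-Solver
  degree≤Δ : ∀ v → degree G v ≤ Δ
  degree≤Δ v = subst (degree G v ≤_) maxDegree≡Δ (degree≤maxDegree G v)
  count : n + Δ * (n * Δ) ≡ (Δ * Δ + 1) * n
  count = solve 2 (λ N D → N :+ D :* (N :* D) := (D :* D :+ con 1) :* N) refl n Δ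
  room : n + Δ * (n * Δ) ≤ l
  room = ≤-trans (≤-reflexive count) (≤-trans (m≤m+n _ _) enough)
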